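{- Let $\mathcal{B}$ be a complete Boolean algebra, $\mathcal{U}$ an ultrafilter on $\mathcal{B}$, $I$ an index set, $\mathbf{A}$ an $I$-distribution in $\mathcal{U}$, and $\mathbf{B}$ a conservative refinement of $\mathbf{A}$ which is in $\mathcal{U}$. Then $\mathbf{B}$ has a multiplicative refinement in $\mathcal{U}$ if and only if $\mathbf{A}$ does.
   Context: An $I$-distribution in $\mathcal{B}$ is a map $\mathbf{A}:[I]^{<\aleph_0}\to\mathcal{B}\setminus\{0\}$ with $\mathbf{A}(\emptyset)=1$ and $s\subseteq t\Rightarrow\mathbf{A}(s)\ge\mathbf{A}(t)$; it is in $\mathcal{U}$ if its image is contained in $\mathcal{U}$; it is multiplicative if $\mathbf{A}(s)=\bigwedge_{i\in s}\mathbf{A}(\{i\})$ for all $s$. $\mathbf{B}$ refines $\mathbf{A}$ if $\mathbf{B}(s)\le\mathbf{A}(s)$ for all $s$. $\mathbf{B}$ conservatively refines $\mathbf{A}$ if there is a multiplicative $I$-distribution $\mathbf{C}$ with $\mathbf{B}(s)=\mathbf{A}(s)\wedge\mathbf{C}(s)$ for all $s$ (equivalently $\mathbf{B}(s)=\mathbf{A}(s)\wedge\bigwedge_{i\in s}\mathbf{B}(\{i\})$ for all $s$). -}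

module Defs where

open import Level using (Level; _⊔_; suc; Setω)
open import Algebra.Lattice.Bundles using (BooleanAlgebra)
open import Data.List using (List; []; _∷_; [_]; foldr)
open import Data.List.Membership.Propositional using (_∈_)
open import Data.Product using (Σ; _×_; ∃)
open import Data.Sum using (_⊎_)
open import Relation.Nullary using (¬_)

-- Finite subsets of I are represented by lists; s ⊆ t means every member of s is in t.
_⊆ₗ_ : ∀ {i} {I : Set i} → List I → List I → Set i
s ⊆ₗ t = ∀ {x} → x ∈ s → x ∈ t

module _ {c ℓ : Level} (𝔹 : BooleanAlgebra c ℓ) where
  open BooleanAlgebra 𝔹 renaming (¬_ to ∁_)

  _≤ᴮ_ : Carrier → Carrier → Set ℓ
  x ≤ᴮ y = (x ∧ y) ≈ x

  IsGLB : ∀ {j} {J : Set j} → (J → Carrier) → Carrier → Set (c ⊔ ℓ ⊔ j)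
  IsGLB {J = J} f m = (∀ k → m ≤ᴮ f k) × (∀ y → (∀ k → y ≤ᴮ f k) → y ≤ᴮ m)

  IsComplete : Setω
  IsComplete = ∀ {j} (J : Set j) (f : J → Carrier) → Σ Carrier (IsGLB f)

  record IsUltrafilter {u} (U : Carrier → Set u) : Set (c ⊔ ℓ ⊔ u) where
    field
      top     : U ⊤
      notBot  : ¬ U ⊥
      upward  : ∀ {x y} → U x → x ≤ᴮ y → U y
      meet    : ∀ {x y} → U x → U y → U (x ∧ y)
      ultra   : ∀ x → U x ⊎ U (∁ x)

  module _ {i : Level} {I : Set i} where

    record IsDistribution (A : List I → Carrier) : Set (c ⊔ ℓ ⊔ i) where
      field
        nonzero : ∀ s → ¬ (A s ≈ ⊥)
        empty   : A [] ≈ ⊤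
        antimono : ∀ s t → s ⊆ₗ t → A t ≤ᴮ A s

    InU : ∀ {u} (U : Carrier → Set u) → (List I → Carrier) → Set (i ⊔ u)
    InU U A = ∀ s → U (A s)

    bigMeetSingletons : (List I → Carrier) → List I → Carrier
    bigMeetSingletons A s = foldr (λ x r → A [ x ] ∧ r) ⊤ s

    IsMultiplicative : (List I → Carrier) → Set (ℓ ⊔ i)
    IsMultiplicative A = ∀ s → A s ≈ bigMeetSingletons A s

    Refines : (List I → Carrier) → (List I → Carrier) → Set (ℓ ⊔ i)
    Refines B' A = ∀ s → B' s ≤ᴮ A s

    ConservativelyRefines : (List I → Carrier) → (List I → Carrier) → Set (c ⊔ ℓ ⊔ i)
    ConservativelyRefines B' A =
      Σ (List I → Carrier) λ C →
        IsDistribution C × IsMultiplicative C × (∀ s → B' s ≈ (A s ∧ C s))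

    HasMultRefinementIn : ∀ {u} (U : Carrier → Set u) → (List I → Carrier) → Set (c ⊔ ℓ ⊔ i ⊔ u)
    HasMultRefinementIn U A =
      Σ (List I → Carrier) λ M →
        IsDistribution M × IsMultiplicative M × InU U M × Refines M A

module Submission where

-- Suppose B(s) = A(s) ∧ C(s) with C a multiplicative distribution.
--   (⇒) Any refinement of B is a refinement of A, because B refines A;
--       so a multiplicative refinement of B in U serves for A as well.
--   (⇐) If M is a multiplicative refinement of A in U, then the pointwise
--       meet M ⊓ C refines A ⊓ C = B, is multiplicative (meets of
--       singleton products multiply pointwise), and lies in U since both
--       M and C do (C lies above B, which is in U).

open import Defs
open import Level using (Level)
open import Algebra.Bundles using (CommutativeMonoid)
open import Algebra.Lattice.Bundles using (BooleanAlgebra)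
import Algebra.Lattice.Properties.BooleanAlgebra as BooleanAlgebraProperties
import Algebra.Properties.CommutativeSemigroup as CommutativeSemigroupProperties
open import Relation.Binary.Lattice using (IsMeetSemilattice)
open import Data.List using (List; []; _∷_)
open import Data.Product using (_×_; _,_; proj₁; proj₂)
open import Relation.Nullary using (¬_)

module OrderFacts {c ℓ : Level} (𝔹 : BooleanAlgebra c ℓ) where
  open BooleanAlgebra 𝔹 hiding (¬_)
  open BooleanAlgebraProperties 𝔹
    using (∧-idem; ∧-isOrderTheoreticMeetSemilattice; ∧-⊤-isCommutativeMonoid)
  open IsMeetSemilattice ∧-isOrderTheoreticMeetSemilattice
    using (x∧y≤x; x∧y≤y; ∧-greatest) renaming (trans to ⊑-trans)

  -- The order x ≤ᴮ y (x ∧ y ≈ x) is the symmetric form of the library's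
  -- natural order x ≈ x ∧ y, so its laws are inherited through sym.
  private
    _≤_ : Carrier → Carrier → Set ℓ
    _≤_ = _≤ᴮ_ 𝔹

  ≤-trans : ∀ {x y z} → x ≤ y → y ≤ z → x ≤ z
  ≤-trans x≤y y≤z = sym (⊑-trans (sym x≤y) (sym y≤z))

  ∧-lowerˡ : ∀ x y → (x ∧ y) ≤ x
  ∧-lowerˡ x y = sym (x∧y≤x x y)

  ∧-lowerʳ : ∀ x y → (x ∧ y) ≤ y
  ∧-lowerʳ x y = sym (x∧y≤y x y)

  ∧-monotone : ∀ {a b x y} → a ≤ b → x ≤ y → (a ∧ x) ≤ (b ∧ y)
  ∧-monotone {a} {b} {x} {y} a≤b x≤y = sym (∧-greatest
    (⊑-trans (x∧y≤x a x) (sym a≤b))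
    (⊑-trans (x∧y≤y a x) (sym x≤y)))

  ≈⇒≤ : ∀ {x y} → x ≈ y → x ≤ y
  ≈⇒≤ {x} {y} x≈y = trans (∧-congˡ (sym x≈y)) (∧-idem x)

  -- (a ∧ b) ∧ (c ∧ d) ≈ (a ∧ c) ∧ (b ∧ d), from the commutative monoid (∧, ⊤).
  ∧-commutativeMonoid : CommutativeMonoid c ℓ
  ∧-commutativeMonoid = record { isCommutativeMonoid = ∧-⊤-isCommutativeMonoid }

  open CommutativeSemigroupProperties
    (CommutativeMonoid.commutativeSemigroup ∧-commutativeMonoid)
    using (interchange) public

module PointwiseMeet {c ℓ i : Level} (𝔹 : BooleanAlgebra c ℓ) (I : Set i) where
  open BooleanAlgebra 𝔹 hiding (¬_)
  open BooleanAlgebraProperties 𝔹 using (∧-idem)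
  open OrderFacts 𝔹

  Family : Set (c Level.⊔ i)
  Family = List I → Carrier

  _⊓_ : Family → Family → Family
  (M ⊓ C) s = M s ∧ C s

  bigMeet-⊓ : ∀ M C s →
    (bigMeetSingletons 𝔹 M s ∧ bigMeetSingletons 𝔹 C s)
      ≈ bigMeetSingletons 𝔹 (M ⊓ C) s
  bigMeet-⊓ M C []      = ∧-idem ⊤
  bigMeet-⊓ M C (x ∷ s) = trans (interchange _ _ _ _) (∧-congˡ (bigMeet-⊓ M C s))

  ⊓-multiplicative : ∀ {M C} →
    IsMultiplicative 𝔹 M → IsMultiplicative 𝔹 C → IsMultiplicative 𝔹 (M ⊓ C)
  ⊓-multiplicative {M} {C} multM multC s =
    trans (∧-cong (multM s) (multC s)) (bigMeet-⊓ M C s)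

  ⊓-distribution : ∀ {M C} → IsDistribution 𝔹 M → IsDistribution 𝔹 C →
    (∀ s → ¬ ((M ⊓ C) s ≈ ⊥)) → IsDistribution 𝔹 (M ⊓ C)
  ⊓-distribution distM distC nonzero = record
    { nonzero  = nonzero
    ; empty    = trans (∧-cong (D.empty distM) (D.empty distC)) (∧-idem ⊤)
    ; antimono = λ s t s⊆t →
        ∧-monotone (D.antimono distM s t s⊆t) (D.antimono distC s t s⊆t)
    }
    where module D = IsDistribution

  refines-trans : ∀ {X Y Z : Family} → Refines 𝔹 X Y → Refines 𝔹 Y Z → Refines 𝔹 X Z
  refines-trans X≤Y Y≤Z s = ≤-trans (X≤Y s) (Y≤Z s)

  ⊓-refines : ∀ {M A : Family} C → Refines 𝔹 M A → Refines 𝔹 (M ⊓ C) (A ⊓ C)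
  ⊓-refines C M≤A s = ∧-monotone (M≤A s) (≈⇒≤ refl)

  module Conservative {A B : Family} (conservative : ConservativelyRefines 𝔹 B A) where
    factor : Family
    factor = proj₁ conservative

    factor-distribution : IsDistribution 𝔹 factor
    factor-distribution = proj₁ (proj₂ conservative)

    factor-multiplicative : IsMultiplicative 𝔹 factor
    factor-multiplicative = proj₁ (proj₂ (proj₂ conservative))

    B≈A⊓C : ∀ s → B s ≈ (A ⊓ factor) s
    B≈A⊓C = proj₂ (proj₂ (proj₂ conservative))

    refines-A : Refines 𝔹 B A
    refines-A s = ≤-trans (≈⇒≤ (B≈A⊓C s)) (∧-lowerˡ (A s) (factor s))

    refines-factor : Refines 𝔹 B factor
    refines-factor s = ≤-trans (≈⇒≤ (B≈A⊓C s)) (∧-lowerʳ (A s) (factor s))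

    into-B : ∀ {M : Family} → Refines 𝔹 M (A ⊓ factor) → Refines 𝔹 M B
    into-B M≤A⊓C s = ≤-trans (M≤A⊓C s) (≈⇒≤ (sym (B≈A⊓C s)))

module InFilter {c ℓ i u : Level} (𝔹 : BooleanAlgebra c ℓ) (I : Set i)
    (U : BooleanAlgebra.Carrier 𝔹 → Set u)
    (upward : ∀ {x y} → U x → _≤ᴮ_ 𝔹 x y → U y)
    (meet : ∀ {x y} → U x → U y → U (BooleanAlgebra._∧_ 𝔹 x y))
    (notBot : ¬ U (BooleanAlgebra.⊥ 𝔹)) where
  open BooleanAlgebra 𝔹 hiding (¬_)
  open BooleanAlgebraProperties 𝔹 using (∧-zeroʳ)
  open PointwiseMeet 𝔹 I

  -- Members of U are nonzero, so distributions in U avoid 0 automatically.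
  inU-nonzero : ∀ {x} → U x → ¬ (x ≈ ⊥)
  inU-nonzero {x} x∈U x≈⊥ = notBot (upward x∈U (trans (∧-zeroʳ x) (sym x≈⊥)))

  inU-upward : ∀ {X Y : Family} → Refines 𝔹 X Y → InU 𝔹 U X → InU 𝔹 U Y
  inU-upward X≤Y X∈U s = upward (X∈U s) (X≤Y s)

  ⊓-inU : ∀ {X Y : Family} → InU 𝔹 U X → InU 𝔹 U Y → InU 𝔹 U (X ⊓ Y)
  ⊓-inU X∈U Y∈U s = meet (X∈U s) (Y∈U s)

  multRefinement-up : ∀ {A B : Family} → Refines 𝔹 B A →
    HasMultRefinementIn 𝔹 U B → HasMultRefinementIn 𝔹 U A
  multRefinement-up B≤A (M , distM , multM , M∈U , M≤B) =
    M , distM , multM , M∈U , refines-trans M≤B B≤A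

  multRefinement-conservative : ∀ {A B : Family} → ConservativelyRefines 𝔹 B A →
    InU 𝔹 U B → HasMultRefinementIn 𝔹 U A → HasMultRefinementIn 𝔹 U B
  multRefinement-conservative conservative B∈U (M , distM , multM , M∈U , M≤A) =
    M ⊓ factor ,
    ⊓-distribution distM factor-distribution (λ s → inU-nonzero (M⊓C∈U s)) ,
    ⊓-multiplicative multM factor-multiplicative ,
    M⊓C∈U ,
    into-B (⊓-refines factor M≤A)
    where
    open Conservative conservative
    M⊓C∈U : InU 𝔹 U (M ⊓ factor)
    M⊓C∈U = ⊓-inU M∈U (inU-upward refines-factor B∈U)

lemma5p2 : ∀ {c ℓ i u : Level} (𝔹 : BooleanAlgebra c ℓ) → IsComplete 𝔹 →
    (U : BooleanAlgebra.Carrier 𝔹 → Set u) → IsUltrafilter 𝔹 U →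
    (I : Set i) (A B : List I → BooleanAlgebra.Carrier 𝔹) →
    IsDistribution 𝔹 A → InU 𝔹 U A →
    IsDistribution 𝔹 B → ConservativelyRefines 𝔹 B A → InU 𝔹 U B →
    (HasMultRefinementIn 𝔹 U B → HasMultRefinementIn 𝔹 U A)
    × (HasMultRefinementIn 𝔹 U A → HasMultRefinementIn 𝔹 U B)
lemma5p2 𝔹 _ U ultrafilter I A B _ _ _ conservative B∈U =
  multRefinement-up (Conservative.refines-A conservative) ,
  multRefinement-conservative conservative B∈U
  where
  open IsUltrafilter ultrafilter using (upward; meet; notBot)
  open InFilter 𝔹 I U upward meet notBot
  open PointwiseMeet 𝔹 I using (module Conservative)
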